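{- Fix a total order $<$ on the ground sets involved. Suppose that for each $m$, $\mathcal{F}$ and $\mathcal{G}$ (depending on $m$) are families of subsets of the same finite set with $\mathcal{F}\supseteq\mathcal{G}$, $Z_<(\mathcal{F})=O(f(m))$ and $Z_<(\mathcal{G})=\Omega(g(m))$. Then $Z_<(\mathcal{F}\setminus\mathcal{G})=\Omega(g(m)/f(m))$.
   Context: A family of sets is a set of subsets of a finite ground set $U$. A zero-suppressed binary decision diagram (ZDD) with respect to a total order $<$ on $U$ is a rooted DAG with two terminal nodes $\top,\bot$ and internal nodes $\mathtt{n}$, each with a label $\mathsf{lb}(\mathtt{n})\in U$ and children $\mathsf{lo}(\mathtt{n}),\mathsf{hi}(\mathtt{n})$, labels strictly increasing along arcs. A node represents: $\{\emptyset\}$ if $\top$, $\emptyset$ if $\bot$, and $\mathcal{F}_{\mathsf{lo}(\mathtt{n})}\cup\{\{\mathsf{lb}(\mathtt{n})\}\cup S\mid S\in\mathcal{F}_{\mathsf{hi}(\mathtt{n})}\}$ otherwise; the ZDD represents the family of its root. The reduced ZDD (obtained by merging nodes with identical label and children and deleting nodes whose hi-child is $\bot$) is the unique smallest ZDD for the family and order; $Z_<(\mathcal{F})$ is its number of nodes. Asymptotics are as $m\to\infty$.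
   Formalization: The functions f and g in the asymptotic bounds take values in the rationals. -}

module Defs where

open import Data.Nat using (ℕ; _+_)
import Data.Nat as ℕ
open import Data.Fin using (Fin)
import Data.Fin as Fin
open import Data.Fin.Subset using (Subset; ⁅_⁆) renaming (⊥ to ∅ˢ; _∪_ to _∪ˢ_)
open import Data.Bool using (Bool; true; false; _∧_; not)
open import Data.Product using (Σ; ∃; ∃-syntax; _×_; _,_)
open import Data.Sum using (_⊎_)
open import Data.Rational using (ℚ; _≤_; _<_; _*_; ∣_∣; 0ℚ)
import Data.Integer as ℤ
open import Relation.Binary.PropositionalEquality using (_≡_)
open import Function.Bundles using (_⇔_)

-- Ground set: Fin n with its natural (total) order Fin._<_.
-- A family of sets over Fin n, given by its (decidable) characteristic function.
Family : ℕ → Set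
Family n = Subset n → Bool

_⊇ᶠ_ : ∀ {n} → Family n → Family n → Set
F ⊇ᶠ G = ∀ S → G S ≡ true → F S ≡ true

_∖ᶠ_ : ∀ {n} → Family n → Family n → Family n
(F ∖ᶠ G) S = F S ∧ not (G S)

data Ref (k : ℕ) : Set where
  top : Ref k
  bot : Ref k
  node : Fin k → Ref k

record ZDD (n k : ℕ) : Set where
  field
    lb   : Fin k → Fin n
    lo   : Fin k → Ref k
    hi   : Fin k → Ref k
    lo-ordered : ∀ i j → lo i ≡ node j → lb i Fin.< lb j
    hi-ordered : ∀ i j → hi i ≡ node j → lb i Fin.< lb j
    root : Ref k

-- Number of nodes: k internal nodes plus the two terminals.
size : ∀ {n k} → ZDD n k → ℕ
size {k = k} _ = k + 2

data _∈⟦_⟧_ {n k : ℕ} : Subset n → Ref k → ZDD n k → Set where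
  ∈top : ∀ {Z} → ∅ˢ ∈⟦ top ⟧ Z
  ∈lo  : ∀ {Z S i} → S ∈⟦ ZDD.lo Z i ⟧ Z → S ∈⟦ node i ⟧ Z
  ∈hi  : ∀ {Z S i} → S ∈⟦ ZDD.hi Z i ⟧ Z → (⁅ ZDD.lb Z i ⁆ ∪ˢ S) ∈⟦ node i ⟧ Z

Represents : ∀ {n k} → ZDD n k → Family n → Set
Represents Z F = ∀ S → (F S ≡ true) ⇔ (S ∈⟦ ZDD.root Z ⟧ Z)

-- IsZ F z : z = Z_<(F), the number of nodes of the smallest ZDD (equivalently
-- the reduced ZDD) representing F w.r.t. the order on Fin n.
IsZ : ∀ {n} → Family n → ℕ → Set
IsZ {n} F z =
  (∃[ k ] Σ (ZDD n k) λ Z → Represents Z F × size Z ≡ z)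
  × (∀ k (Z : ZDD n k) → Represents Z F → z ℕ.≤ size Z)

ℕ→ℚ : ℕ → ℚ
ℕ→ℚ m = Data.Rational._/_ (ℤ.+ m) 1

IsBigO : (ℕ → ℚ) → (ℕ → ℚ) → Set
IsBigO h f = ∃[ C ] ∃[ M ] (∀ m → M ℕ.≤ m → ∣ h m ∣ ≤ C * ∣ f m ∣)

IsBigΩ : (ℕ → ℚ) → (ℕ → ℚ) → Set
IsBigΩ h g = ∃[ c ] (0ℚ < c) × ∃[ M ] (∀ m → M ℕ.≤ m → c * ∣ g m ∣ ≤ ∣ h m ∣)

-- h = Ω(g/f), with the division cleared: c·|g m| ≤ |h m|·|f m|.
-- (Faithful whenever f m ≠ 0 eventually, which holds under the hypothesis
-- Z_<(F) = O(f) since Z_<(F) ≥ 2.)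
IsBigΩRatio : (ℕ → ℚ) → (ℕ → ℚ) → (ℕ → ℚ) → Set
IsBigΩRatio h g f =
  ∃[ c ] (0ℚ < c) × ∃[ M ] (∀ m → M ℕ.≤ m → c * ∣ g m ∣ ≤ ∣ h m ∣ * ∣ f m ∣)

-- Since G ⊆ F we have G = F ∖ (F ∖ G), so it suffices to bound the ZDD of a difference
-- F ∖ H. The product construction does this: its nodes are pairs (p , q) of nodes of ZDDs
-- for F and H, the pair standing for 𝓕_p ∖ 𝓗_q; it is labelled by the smaller of the two
-- labels and its children are the pairs of the corresponding children. Hence
-- Z(G) ≤ Z(F) · Z(F ∖ G), and combining Z(G) ≥ c · g with Z(F) ≤ C · f gives
-- Z(F ∖ G) ≥ (c / C) · g / f.

module Submission where

open import Defs
open import Data.Nat as ℕ using (ℕ)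
import Data.Nat.Properties as ℕ
open import Data.Rational as ℚ using (ℚ)
open import Function using (_∘_)
open import Relation.Binary.PropositionalEquality using (_≡_; _≢_; _≗_; refl; sym; trans; cong; subst; subst₂)

module _ where
  open import Data.Nat using (_+_; _*_)
  open import Data.Nat.Tactic.RingSolver using (solve-∀)
  open import Data.Fin as Fin using (Fin)
  open import Data.Fin.Induction using (>-wellFounded)
  open import Data.Fin.Subset using (Subset; ⁅_⁆; _∈_; _∉_; _⊆_) renaming (⊥ to ∅ˢ; _∪_ to _∪ˢ_)
  open import Data.Fin.Subset.Properties using (x∈⁅x⁆; x∈⁅y⁆⇒x≡y; x∈p∪q⁻; x∈p∪q⁺; ∉⊥; ⊆-antisym)
  open import Data.Fin.Properties as FinP using (+↔⊎; *↔×)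
  open import Data.Product using (_×_; _,_)
  open import Function.Bundles using (_↩_; _↔_; mk↔ₛ′; LeftInverse; _⇔_; mk⇔; Equivalence)
  open import Function.Properties.Inverse using (↔-refl; ↔-trans; ↔⇒↩)
  open import Data.Sum.Function.Propositional using (_⊎-↔_)
  open import Data.Product.Function.NonDependent.Propositional using (_×-↔_)
  open import Data.Sum using (_⊎_; inj₁; inj₂; [_,_])
  open import Data.Unit using (⊤; tt)
  open import Data.Empty using (⊥; ⊥-elim)
  open import Data.Bool using (true; false)
  open import Induction.WellFounded using (Acc; acc)
  open import Relation.Nullary using (¬_; contradiction)
  open import Relation.Binary using (tri<; tri≈; tri>)

  module _ {n : ℕ} {x : Fin n} where

    x∈⁅x⁆∪p : ∀ p → x ∈ ⁅ x ⁆ ∪ˢ p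
    x∈⁅x⁆∪p p = x∈p∪q⁺ (inj₁ (x∈⁅x⁆ x))

    ⁅x⁆∪-cancel : ∀ {p q} → x ∉ p → x ∉ q → ⁅ x ⁆ ∪ˢ p ≡ ⁅ x ⁆ ∪ˢ q → p ≡ q
    ⁅x⁆∪-cancel x∉p x∉q eq = ⊆-antisym (⊆-cancel x∉p eq) (⊆-cancel x∉q (sym eq))
      where
      ⊆-cancel : ∀ {p q} → x ∉ p → ⁅ x ⁆ ∪ˢ p ≡ ⁅ x ⁆ ∪ˢ q → p ⊆ q
      ⊆-cancel {p} {q} x∉p eq {y} y∈p with x∈p∪q⁻ ⁅ x ⁆ q (subst (y ∈_) eq (x∈p∪q⁺ (inj₂ y∈p)))
      ... | inj₁ y∈⁅x⁆ = contradiction (subst (_∈ p) (x∈⁅y⁆⇒x≡y x y∈⁅x⁆) y∈p) x∉p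
      ... | inj₂ y∈q   = y∈q

  module _ {n : ℕ} (F G : Family n) (S : Subset n) where

    ∖ᶠ-true⇔ : ((F ∖ᶠ G) S ≡ true) ⇔ (F S ≡ true × G S ≢ true)
    ∖ᶠ-true⇔ with F S | G S
    ... | true  | true  = mk⇔ (λ ()) (λ (_ , ¬GS) → contradiction refl ¬GS)
    ... | true  | false = mk⇔ (λ _ → refl , λ ()) (λ _ → refl)
    ... | false | _     = mk⇔ (λ ()) (λ { (() , _) })

  Represents-resp : ∀ {n k} {Z : ZDD n k} {F F′ : Family n} → F ≗ F′ → Represents Z F → Represents Z F′
  Represents-resp F≗F′ rep S =
    mk⇔ (Equivalence.to (rep S) ∘ trans (F≗F′ S)) (trans (sym (F≗F′ S)) ∘ Equivalence.from (rep S))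

  ⊇ᶠ⇒∖ᶠ-∖ᶠ : ∀ {n} {F G : Family n} → F ⊇ᶠ G → F ∖ᶠ (F ∖ᶠ G) ≗ G
  ⊇ᶠ⇒∖ᶠ-∖ᶠ {F = F} {G} F⊇G S with G S in GS | F S in FS
  ... | true  | true  = refl
  ... | true  | false = contradiction (trans (sym (F⊇G S GS)) FS) λ ()
  ... | false | true  = refl
  ... | false | false = refl

  module _ {n k : ℕ} (Z : ZDD n k) where
    open ZDD Z

    Below : Fin n → Ref k → Set
    Below ℓ (node j) = ℓ Fin.< lb j
    Below ℓ _        = ⊤

    lb-Below-lo : ∀ i → Below (lb i) (lo i)
    lb-Below-lo i with lo i in eq
    ... | top    = tt
    ... | bot    = tt
    ... | node j = lo-ordered i j eq

    lb-Below-hi : ∀ i → Below (lb i) (hi i)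
    lb-Below-hi i with hi i in eq
    ... | top    = tt
    ... | bot    = tt
    ... | node j = hi-ordered i j eq

    Below-<-trans : ∀ {ℓ ℓ′} r → ℓ Fin.< ℓ′ → Below ℓ′ r → Below ℓ r
    Below-<-trans top      _    _     = tt
    Below-<-trans bot      _    _     = tt
    Below-<-trans (node j) ℓ<ℓ′ ℓ′<lb = FinP.<-trans ℓ<ℓ′ ℓ′<lb

    data LoTerminates : Ref k → Set where
      top  : LoTerminates top
      bot  : LoTerminates bot
      node : ∀ {j} → LoTerminates (lo j) → LoTerminates (node j)

    loTerminates : ∀ r → LoTerminates r
    loTerminates top      = top
    loTerminates bot      = bot
    loTerminates (node j) = node (below j (>-wellFounded (lb j)))
      where
      below : ∀ j → Acc Fin._>_ (lb j) → LoTerminates (lo j)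
      below j (acc rec) with lo j in eq
      ... | top     = top
      ... | bot     = bot
      ... | node j′ = node (below j′ (rec (lo-ordered j j′ eq)))

  module _ {n k : ℕ} {Z : ZDD n k} where
    open ZDD Z

    Below-∉ : ∀ {ℓ S r} → Below Z ℓ r → S ∈⟦ r ⟧ Z → ℓ ∉ S
    Below-∉ _    ∈top                      = ∉⊥
    Below-∉ ℓ<lb (∈lo {i = i} S∈lo)         =
      Below-∉ (Below-<-trans Z (lo i) ℓ<lb (lb-Below-lo Z i)) S∈lo
    Below-∉ ℓ<lb (∈hi {S = S} {i = i} S∈hi) ℓ∈S with x∈p∪q⁻ ⁅ lb i ⁆ S ℓ∈S
    ... | inj₁ ℓ∈⁅lb⁆ = FinP.<-irrefl (x∈⁅y⁆⇒x≡y _ ℓ∈⁅lb⁆) ℓ<lb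
    ... | inj₂ ℓ∈S    = Below-∉ (Below-<-trans Z (hi i) ℓ<lb (lb-Below-hi Z i)) S∈hi ℓ∈S

    ∈node⇒∈lo⊎lb∈ : ∀ {S j} → S ∈⟦ node j ⟧ Z → S ∈⟦ lo j ⟧ Z ⊎ lb j ∈ S
    ∈node⇒∈lo⊎lb∈ (∈lo S∈lo)          = inj₁ S∈lo
    ∈node⇒∈lo⊎lb∈ (∈hi {S = S} S∈hi) = inj₂ (x∈⁅x⁆∪p S)

    ∈node⇒∈hi : ∀ {S j} → lb j ∉ S → (⁅ lb j ⁆ ∪ˢ S) ∈⟦ node j ⟧ Z → S ∈⟦ hi j ⟧ Z
    ∈node⇒∈hi {S} {j} lb∉S = invert refl
      where
      invert : ∀ {T} → T ≡ ⁅ lb j ⁆ ∪ˢ S → T ∈⟦ node j ⟧ Z → S ∈⟦ hi j ⟧ Z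
      invert eq (∈lo T∈lo)  = ⊥-elim (Below-∉ (lb-Below-lo Z j) T∈lo (subst (lb j ∈_) (sym eq) (x∈⁅x⁆∪p S)))
      invert eq (∈hi S′∈hi) =
        subst (_∈⟦ hi j ⟧ Z) (⁅x⁆∪-cancel (Below-∉ (lb-Below-hi Z j) S′∈hi) lb∉S eq) S′∈hi

  -- Diagrams over an arbitrary type of nodes

  data Ptr (I : Set) : Set where
    top bot : Ptr I
    node    : I → Ptr I

  record Diagram (n : ℕ) (I : Set) : Set where
    field
      lb         : I → Fin n
      lo hi      : I → Ptr I
      lo-ordered : ∀ i j → lo i ≡ node j → lb i Fin.< lb j
      hi-ordered : ∀ i j → hi i ≡ node j → lb i Fin.< lb j

  data _∈⟨_⟩_ {n : ℕ} {I : Set} : Subset n → Ptr I → Diagram n I → Set where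
    ∈top : ∀ {D} → ∅ˢ ∈⟨ top ⟩ D
    ∈lo  : ∀ {D S i} → S ∈⟨ Diagram.lo D i ⟩ D → S ∈⟨ node i ⟩ D
    ∈hi  : ∀ {D S i} → S ∈⟨ Diagram.hi D i ⟩ D → (⁅ Diagram.lb D i ⁆ ∪ˢ S) ∈⟨ node i ⟩ D

  -- Elements of Fin k outside the image of encode become unreachable junk nodes.
  module Compact {n k : ℕ} {I : Set} (D : Diagram n I) (Fin↩I : Fin k ↩ I) where
    open Diagram D
    open LeftInverse Fin↩I renaming (to to decode; from to encode)

    encodePtr : Ptr I → Ref k
    encodePtr top      = top
    encodePtr bot      = bot
    encodePtr (node i) = node (encode i)

    decodeRef : Ref k → Ptr I
    decodeRef top      = top
    decodeRef bot      = bot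
    decodeRef (node x) = node (decode x)

    decodeRef-encodePtr : ∀ r → decodeRef (encodePtr r) ≡ r
    decodeRef-encodePtr top      = refl
    decodeRef-encodePtr bot      = refl
    decodeRef-encodePtr (node i) = cong node (strictlyInverseˡ i)

    toZDD : Ptr I → ZDD n k
    toZDD root = record
      { lb         = lb ∘ decode
      ; lo         = encodePtr ∘ lo ∘ decode
      ; hi         = encodePtr ∘ hi ∘ decode
      ; lo-ordered = λ x y → ordered lo lo-ordered (decode x) y
      ; hi-ordered = λ x y → ordered hi hi-ordered (decode x) y
      ; root       = encodePtr root
      }
      where
      ordered : (child : I → Ptr I) → (∀ i j → child i ≡ node j → lb i Fin.< lb j) →
                ∀ i y → encodePtr (child i) ≡ node y → lb i Fin.< lb (decode y)
      ordered child child-ordered i y eq with child i in eq′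
      ordered child child-ordered i y refl | node j =
        subst (λ j → lb i Fin.< lb j) (sym (strictlyInverseˡ j)) (child-ordered i j eq′)

    module _ {root : Ptr I} where
      private Z = toZDD root

      ∈-toZDD⁺ : ∀ {S r} → S ∈⟨ r ⟩ D → S ∈⟦ encodePtr r ⟧ Z
      ∈-toZDD⁺ ∈top                  = ∈top
      ∈-toZDD⁺ (∈lo {i = i} S∈lo)    = ∈lo′ (strictlyInverseˡ i) (∈-toZDD⁺ S∈lo)
        where
        ∈lo′ : ∀ {S x i} → decode x ≡ i → S ∈⟦ encodePtr (lo i) ⟧ Z → S ∈⟦ node x ⟧ Z
        ∈lo′ refl = ∈lo
      ∈-toZDD⁺ (∈hi {i = i} S∈hi)    = ∈hi′ (strictlyInverseˡ i) (∈-toZDD⁺ S∈hi)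
        where
        ∈hi′ : ∀ {S x i} → decode x ≡ i → S ∈⟦ encodePtr (hi i) ⟧ Z → (⁅ lb i ⁆ ∪ˢ S) ∈⟦ node x ⟧ Z
        ∈hi′ refl = ∈hi

      ∈-toZDD⁻ : ∀ {S ρ} → S ∈⟦ ρ ⟧ Z → S ∈⟨ decodeRef ρ ⟩ D
      ∈-toZDD⁻ ∈top                   = ∈top
      ∈-toZDD⁻ (∈lo {S = S} {i = x} S∈lo) =
        ∈lo (subst (S ∈⟨_⟩ D) (decodeRef-encodePtr (lo (decode x))) (∈-toZDD⁻ S∈lo))
      ∈-toZDD⁻ (∈hi {S = S} {i = x} S∈hi) =
        ∈hi (subst (S ∈⟨_⟩ D) (decodeRef-encodePtr (hi (decode x))) (∈-toZDD⁻ S∈hi))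

    toZDD-represents : ∀ {root F} → (∀ S → (F S ≡ true) ⇔ S ∈⟨ root ⟩ D) → Represents (toZDD root) F
    toZDD-represents {root} rep S = mk⇔
      (λ FS → ∈-toZDD⁺ (Equivalence.to (rep S) FS))
      (λ S∈ → Equivalence.from (rep S) (subst (S ∈⟨_⟩ D) (decodeRef-encodePtr root) (∈-toZDD⁻ S∈)))

  -- The difference of two ZDDs

  Fin↔Ref : ∀ {k} → Fin (2 + k) ↔ Ref k
  Fin↔Ref = mk↔ₛ′ toRef fromRef toRef∘fromRef fromRef∘toRef
    where
    toRef : ∀ {k} → Fin (2 + k) → Ref k
    toRef Fin.zero             = top
    toRef (Fin.suc Fin.zero)   = bot
    toRef (Fin.suc (Fin.suc i)) = node i
    fromRef : ∀ {k} → Ref k → Fin (2 + k)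
    fromRef top      = Fin.zero
    fromRef bot      = Fin.suc Fin.zero
    fromRef (node i) = Fin.suc (Fin.suc i)
    toRef∘fromRef : ∀ {k} (r : Ref k) → toRef (fromRef r) ≡ r
    toRef∘fromRef top      = refl
    toRef∘fromRef bot      = refl
    toRef∘fromRef (node i) = refl
    fromRef∘toRef : ∀ {k} (x : Fin (2 + k)) → fromRef (toRef x) ≡ x
    fromRef∘toRef Fin.zero              = refl
    fromRef∘toRef (Fin.suc Fin.zero)    = refl
    fromRef∘toRef (Fin.suc (Fin.suc i)) = refl

  module Difference {n k₁ k₂ : ℕ} (A : ZDD n k₁) (B : ZDD n k₂) where
    private
      module A = ZDD A
      module B = ZDD B

    -- The node for (p , q), with p in A and q in B, represents 𝓕_p ∖ 𝓗_q;
    -- inj₁ j is the pair (⊤ , j).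
    Node : Set
    Node = Fin k₂ ⊎ (Fin k₁ × Ref k₂)

    pair : Ref k₁ → Ref k₂ → Ptr Node
    pair bot      _        = bot
    pair top      bot      = top
    pair top      top      = bot
    pair top      (node j) = node (inj₁ j)
    pair (node i) q        = node (inj₂ (i , q))

    -- A terminal q counts as carrying a label above every element.
    data Compare (i : Fin k₁) : Ref k₂ → Set where
      A-first : ∀ {q} → Below B (A.lb i) q → Compare i q
      same    : ∀ {j} → A.lb i ≡ B.lb j → Compare i (node j)
      B-first : ∀ {j} → B.lb j Fin.< A.lb i → Compare i (node j)

    compare : ∀ i q → Compare i q
    compare i top      = A-first tt
    compare i bot      = A-first tt
    compare i (node j) with FinP.<-cmp (A.lb i) (B.lb j)
    ... | tri< i<j _ _ = A-first i<j
    ... | tri≈ _ i≡j _ = same i≡j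
    ... | tri> _ _ j<i = B-first j<i

    lbᶜ : ∀ {i q} → Compare i q → Fin n
    lbᶜ {i}     (A-first _) = A.lb i
    lbᶜ {i}     (same _)    = A.lb i
    lbᶜ         (B-first {j} _) = B.lb j

    loᶜ hiᶜ : ∀ {i q} → Compare i q → Ptr Node
    loᶜ {i} {q} (A-first _)       = pair (A.lo i) q
    loᶜ {i}     (same {j} _)      = pair (A.lo i) (B.lo j)
    loᶜ {i}     (B-first {j} _)   = pair (node i) (B.lo j)
    hiᶜ {i}     (A-first _)       = pair (A.hi i) bot
    hiᶜ {i}     (same {j} _)      = pair (A.hi i) (B.hi j)
    hiᶜ         (B-first _)       = bot

    lbᴰ : Node → Fin n
    lbᴰ (inj₁ j)       = B.lb j
    lbᴰ (inj₂ (i , q)) = lbᶜ (compare i q)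

    loᴰ hiᴰ : Node → Ptr Node
    loᴰ (inj₁ j)       = pair top (B.lo j)
    loᴰ (inj₂ (i , q)) = loᶜ (compare i q)
    hiᴰ (inj₁ j)       = bot
    hiᴰ (inj₂ (i , q)) = hiᶜ (compare i q)

    Below-pair : ∀ {ℓ p q d} → Below A ℓ p → Below B ℓ q → pair p q ≡ node d → ℓ Fin.< lbᴰ d
    Below-pair {p = top}      {node j} _    ℓ<j refl = ℓ<j
    Below-pair {p = node i}   {q}      ℓ<i  ℓ<q refl with compare i q
    ... | A-first _ = ℓ<i
    ... | same _    = ℓ<i
    ... | B-first _ = ℓ<q

    loᴰ-ordered : ∀ d d′ → loᴰ d ≡ node d′ → lbᴰ d Fin.< lbᴰ d′
    loᴰ-ordered (inj₁ j) _ = Below-pair tt (lb-Below-lo B j)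
    loᴰ-ordered (inj₂ (i , q)) _ with compare i q
    ... | A-first i<q    = Below-pair (lb-Below-lo A i) i<q
    ... | same {j} i≡j   = Below-pair (lb-Below-lo A i) (subst (λ ℓ → Below B ℓ (B.lo j)) (sym i≡j) (lb-Below-lo B j))
    ... | B-first {j} j<i = Below-pair j<i (lb-Below-lo B j)

    hiᴰ-ordered : ∀ d d′ → hiᴰ d ≡ node d′ → lbᴰ d Fin.< lbᴰ d′
    hiᴰ-ordered (inj₂ (i , q)) _ with compare i q
    ... | A-first _    = Below-pair (lb-Below-hi A i) tt
    ... | same {j} i≡j = Below-pair (lb-Below-hi A i) (subst (λ ℓ → Below B ℓ (B.hi j)) (sym i≡j) (lb-Below-hi B j))

    diagram : Diagram n Node
    diagram = record
      { lb = lbᴰ ; lo = loᴰ ; hi = hiᴰ ; lo-ordered = loᴰ-ordered ; hi-ordered = hiᴰ-ordered }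

    InPair : Subset n → Ref k₁ → Ref k₂ → Set
    InPair S p q = S ∈⟦ p ⟧ A × ¬ S ∈⟦ q ⟧ B

    InNode : Subset n → Node → Set
    InNode S (inj₁ j)       = InPair S top (node j)
    InNode S (inj₂ (i , q)) = InPair S (node i) q

    InPtr : Subset n → Ptr Node → Set
    InPtr S top      = S ≡ ∅ˢ
    InPtr S bot      = ⊥
    InPtr S (node d) = InNode S d

    InPtr-pair : ∀ {S} p q → InPtr S (pair p q) → InPair S p q
    InPtr-pair top      bot      refl = ∈top , λ ()
    InPtr-pair top      (node j) S∈   = S∈
    InPtr-pair (node i) q        S∈   = S∈

    lo-sound : ∀ {S} d → InPtr S (loᴰ d) → InNode S d
    lo-sound (inj₁ j) S∈ with InPtr-pair top (B.lo j) S∈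
    ... | S∈⊤ , S∉lo = S∈⊤ , [ S∉lo , Below-∉ tt S∈⊤ ] ∘ ∈node⇒∈lo⊎lb∈
    lo-sound {S} (inj₂ (i , q)) S∈ with compare i q
    ... | A-first _ = let (S∈lo , S∉q) = InPtr-pair (A.lo i) q S∈ in ∈lo S∈lo , S∉q
    ... | same {j} i≡j =
      let (S∈lo , S∉lo) = InPtr-pair (A.lo i) (B.lo j) S∈
          lb∉S = subst (_∉ S) i≡j (Below-∉ (lb-Below-lo A i) S∈lo)
      in ∈lo S∈lo , [ S∉lo , lb∉S ] ∘ ∈node⇒∈lo⊎lb∈
    ... | B-first {j} j<i =
      let (S∈i , S∉lo) = InPtr-pair (node i) (B.lo j) S∈
      in S∈i , [ S∉lo , Below-∉ j<i S∈i ] ∘ ∈node⇒∈lo⊎lb∈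

    hi-sound : ∀ {S} d → InPtr S (hiᴰ d) → InNode (⁅ lbᴰ d ⁆ ∪ˢ S) d
    hi-sound {S} (inj₂ (i , q)) S∈ with compare i q
    ... | A-first i<q =
      let (S∈hi , _) = InPtr-pair (A.hi i) bot S∈
      in ∈hi S∈hi , λ S∈q → Below-∉ i<q S∈q (x∈⁅x⁆∪p S)
    ... | same {j} i≡j =
      let (S∈hi , S∉hi) = InPtr-pair (A.hi i) (B.hi j) S∈
          lb∉S = subst (_∉ S) i≡j (Below-∉ (lb-Below-hi A i) S∈hi)
      in ∈hi S∈hi , λ S∈j → S∉hi (∈node⇒∈hi lb∉S (subst (λ ℓ → (⁅ ℓ ⁆ ∪ˢ S) ∈⟦ node j ⟧ B) i≡j S∈j))

    ∈⇒InPtr : ∀ {S r} → S ∈⟨ r ⟩ diagram → InPtr S r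
    ∈⇒InPtr ∈top               = refl
    ∈⇒InPtr (∈lo {i = d} S∈lo) = lo-sound d (∈⇒InPtr S∈lo)
    ∈⇒InPtr (∈hi {i = d} S∈hi) = hi-sound d (∈⇒InPtr S∈hi)

    pair-sound : ∀ {S} p q → S ∈⟨ pair p q ⟩ diagram → InPair S p q
    pair-sound p q = InPtr-pair p q ∘ ∈⇒InPtr

    -- The fields of a pair node are defined by cases on compare i q, which a with on
    -- compare i q cannot rewrite inside the goal; these lemmas take its value as an equation.
    ∈-pair-lo : ∀ {S i q} (c : Compare i q) → compare i q ≡ c →
                S ∈⟨ loᶜ c ⟩ diagram → S ∈⟨ node (inj₂ (i , q)) ⟩ diagram
    ∈-pair-lo _ refl = ∈lo

    ∈-pair-hi : ∀ {S i q} (c : Compare i q) → compare i q ≡ c →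
                S ∈⟨ hiᶜ c ⟩ diagram → (⁅ lbᶜ c ⁆ ∪ˢ S) ∈⟨ node (inj₂ (i , q)) ⟩ diagram
    ∈-pair-hi _ refl = ∈hi

    -- Induction on the derivation for A and, in the B-first case where only q moves,
    -- on the lo-chain of q.
    pair-complete : ∀ {S p q} → S ∈⟦ p ⟧ A → LoTerminates B q → ¬ S ∈⟦ q ⟧ B → S ∈⟨ pair p q ⟩ diagram
    complete-lo : ∀ {S i q} (c : Compare i q) → compare i q ≡ c → S ∈⟦ A.lo i ⟧ A → S ∈⟦ node i ⟧ A →
                  LoTerminates B q → ¬ S ∈⟦ q ⟧ B → S ∈⟨ node (inj₂ (i , q)) ⟩ diagram
    complete-hi : ∀ {S i q} (c : Compare i q) → compare i q ≡ c → S ∈⟦ A.hi i ⟧ A → (⁅ A.lb i ⁆ ∪ˢ S) ∈⟦ node i ⟧ A →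
                  LoTerminates B q → ¬ (⁅ A.lb i ⁆ ∪ˢ S) ∈⟦ q ⟧ B → (⁅ A.lb i ⁆ ∪ˢ S) ∈⟨ node (inj₂ (i , q)) ⟩ diagram

    pair-complete ∈top            bot      _   = ∈top
    pair-complete ∈top            top      S∉q = contradiction ∈top S∉q
    pair-complete ∈top            (node t) S∉q = ∈lo (pair-complete ∈top t (S∉q ∘ ∈lo))
    pair-complete S∈@(∈lo S∈lo) t S∉q = complete-lo (compare _ _) refl S∈lo S∈ t S∉q
    pair-complete S∈@(∈hi S∈hi) t S∉q = complete-hi (compare _ _) refl S∈hi S∈ t S∉q

    complete-lo {q = q} c@(A-first _) eq S∈lo _ _ S∉q = ∈-pair-lo c eq (pair-complete S∈lo (loTerminates B q) S∉q)
    complete-lo c@(same _) eq S∈lo _ _ S∉q = ∈-pair-lo c eq (pair-complete S∈lo (loTerminates B _) (S∉q ∘ ∈lo))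
    complete-lo c@(B-first _) eq _ S∈ (node t) S∉q = ∈-pair-lo c eq (pair-complete S∈ t (S∉q ∘ ∈lo))

    complete-hi c@(A-first _) eq S∈hi _ _ _ = ∈-pair-hi c eq (pair-complete S∈hi bot (λ ()))
    complete-hi {S} c@(same {j} i≡j) eq S∈hi _ _ S∉q = ∈-pair-hi c eq (pair-complete S∈hi (loTerminates B _)
      (λ S∈hiᴮ → S∉q (subst (λ ℓ → (⁅ ℓ ⁆ ∪ˢ S) ∈⟦ node j ⟧ B) (sym i≡j) (∈hi S∈hiᴮ))))
    complete-hi c@(B-first _) eq _ S∈ (node t) S∉q = ∈-pair-lo c eq (pair-complete S∈ t (S∉q ∘ ∈lo))

    Fin↔Node : Fin (k₂ + k₁ * (2 + k₂)) ↔ Node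
    Fin↔Node = ↔-trans +↔⊎ (↔-refl ⊎-↔ ↔-trans *↔× (↔-refl ×-↔ Fin↔Ref))

    difference : ZDD n (k₂ + k₁ * (2 + k₂))
    difference = Compact.toZDD diagram (↔⇒↩ Fin↔Node) (pair A.root B.root)

    difference-represents : ∀ {F H} → Represents A F → Represents B H → Represents difference (F ∖ᶠ H)
    difference-represents {F} {H} repA repB = Compact.toZDD-represents diagram (↔⇒↩ Fin↔Node) λ S → mk⇔
      (λ S∈F∖H → let (FS , ¬HS) = Equivalence.to (∖ᶠ-true⇔ F H S) S∈F∖H in
        pair-complete (Equivalence.to (repA S) FS) (loTerminates B B.root) (¬HS ∘ Equivalence.from (repB S)))
      (λ S∈ → let (S∈A , S∉B) = pair-sound A.root B.root S∈ in
        Equivalence.from (∖ᶠ-true⇔ F H S) (Equivalence.from (repA S) S∈A , S∉B ∘ Equivalence.to (repB S)))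

  difference-size : ∀ k₁ k₂ → k₂ + k₁ * (2 + k₂) + 2 ℕ.≤ (k₁ + 2) * (k₂ + 2)
  difference-size k₁ k₂ = subst (k₂ + k₁ * (2 + k₂) + 2 ℕ.≤_) (sym (identity k₁ k₂)) (ℕ.m≤m+n _ (k₂ + 2))
    where
    identity : ∀ k₁ k₂ → (k₁ + 2) * (k₂ + 2) ≡ k₂ + k₁ * (2 + k₂) + 2 + (k₂ + 2)
    identity = solve-∀

  IsZ-⊇-≤ : ∀ {n} {F G : Family n} {zF zG zD} → F ⊇ᶠ G → IsZ F zF → IsZ G zG → IsZ (F ∖ᶠ G) zD → zG ℕ.≤ zF * zD
  IsZ-⊇-≤ {G = G} F⊇G ((k₁ , A , repA , refl) , _) (_ , G-minimal) ((k₂ , B , repB , refl) , _) =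
    ℕ.≤-trans (G-minimal _ (difference A B) represents-G) (difference-size k₁ k₂)
    where
    open Difference using (difference; difference-represents)
    represents-G : Represents (difference A B) G
    represents-G = Represents-resp (⊇ᶠ⇒∖ᶠ-∖ᶠ F⊇G) (difference-represents A B repA repB)

-- Asymptotics

module _ where
  open import Data.Nat using (_⊔_)
  open import Data.Product using (_,_)
  open import Data.Nat.Coprimality using (1-coprimeTo) renaming (sym to coprime-sym)
  open import Data.Integer as ℤ using (+_)
  open import Data.Integer.Properties using (pos-*) renaming (*-identityʳ to ℤ-*-identityʳ)
  open import Data.Rational using (_≤_; mkℚ; _*_; _+_; ∣_∣; 1ℚ; 1/_; *≤*; Positive; NonZero; positive)
  open import Data.Rational.Solver using (module +-*-Solver)
  open import Data.Rational.Properties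

  ℕ→ℚ≡mkℚ : ∀ a → ℕ→ℚ a ≡ mkℚ (+ a) 0 (coprime-sym (1-coprimeTo a))
  ℕ→ℚ≡mkℚ a = normalize-coprime _

  ∣ℕ→ℚ∣ : ∀ a → ∣ ℕ→ℚ a ∣ ≡ ℕ→ℚ a
  ∣ℕ→ℚ∣ a rewrite ℕ→ℚ≡mkℚ a = refl

  ℕ→ℚ-mono-≤ : ∀ {a b} → a ℕ.≤ b → ℕ→ℚ a ≤ ℕ→ℚ b
  ℕ→ℚ-mono-≤ {a} {b} a≤b rewrite ℕ→ℚ≡mkℚ a | ℕ→ℚ≡mkℚ b =
    *≤* (subst₂ ℤ._≤_ (sym (ℤ-*-identityʳ (+ a))) (sym (ℤ-*-identityʳ (+ b))) (ℤ.+≤+ a≤b))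

  ℕ→ℚ-homo-* : ∀ a b → ℕ→ℚ (a ℕ.* b) ≡ ℕ→ℚ a * ℕ→ℚ b
  ℕ→ℚ-homo-* a b rewrite ℕ→ℚ≡mkℚ a | ℕ→ℚ≡mkℚ b = cong (ℚ._/ 1) (pos-* a b)

  ∣ℕ→ℚ∣-mono-≤-* : ∀ {a b c} → a ℕ.≤ b ℕ.* c → ∣ ℕ→ℚ a ∣ ≤ ∣ ℕ→ℚ b ∣ * ∣ ℕ→ℚ c ∣
  ∣ℕ→ℚ∣-mono-≤-* {a} {b} {c} a≤bc rewrite ∣ℕ→ℚ∣ a | ∣ℕ→ℚ∣ b | ∣ℕ→ℚ∣ c =
    subst (ℕ→ℚ a ≤_) (ℕ→ℚ-homo-* b c) (ℕ→ℚ-mono-≤ a≤bc)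

  bigΩ-ratio : (F G D f g : ℕ → ℚ) → (∀ m → ∣ G m ∣ ≤ ∣ F m ∣ * ∣ D m ∣) →
               IsBigO F f → IsBigΩ G g → IsBigΩRatio D g f
  bigΩ-ratio F G D f g G≤FD (C , M₁ , F≤Cf) (c , c>0 , M₂ , cg≤G) =
    c * 1/ K , positive⁻¹ (c * 1/ K) {{c/K-pos}} , M₁ ⊔ M₂ , cg/K≤Df
    where
    K = ∣ C ∣ + 1ℚ
    instance
      K-pos : Positive K
      K-pos = nonNeg+pos⇒pos ∣ C ∣ {{∣-∣-nonNeg C}} 1ℚ
      K≢0 : NonZero K
      K≢0 = pos⇒nonZero K
    c/K-pos : Positive (c * 1/ K)
    c/K-pos = pos*pos⇒pos c {{positive c>0}} (1/ K) {{1/pos⇒pos K}}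

    ∣C∣≤K : ∣ C ∣ ≤ K
    ∣C∣≤K = subst₂ _≤_ (+-identityʳ ∣ C ∣) refl (+-monoʳ-≤ ∣ C ∣ (nonNegative⁻¹ 1ℚ))

    ∣F∣≤K∣f∣ : ∀ m → M₁ ℕ.≤ m → ∣ F m ∣ ≤ K * ∣ f m ∣
    ∣F∣≤K∣f∣ m M₁≤m = begin
      ∣ F m ∣              ≤⟨ F≤Cf m M₁≤m ⟩
      C * ∣ f m ∣          ≡⟨ sym (0≤p⇒∣p∣≡p (≤-trans (0≤∣p∣ (F m)) (F≤Cf m M₁≤m))) ⟩
      ∣ C * ∣ f m ∣ ∣      ≡⟨ trans (∣p*q∣≡∣p∣*∣q∣ C ∣ f m ∣) (cong (∣ C ∣ *_) (∣∣p∣∣≡∣p∣ (f m))) ⟩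
      ∣ C ∣ * ∣ f m ∣      ≤⟨ *-monoʳ-≤-nonNeg ∣ f m ∣ {{∣-∣-nonNeg (f m)}} ∣C∣≤K ⟩
      K * ∣ f m ∣          ∎
      where open ≤-Reasoning

    open +-*-Solver

    cg/K≤Df : ∀ m → M₁ ⊔ M₂ ℕ.≤ m → c * 1/ K * ∣ g m ∣ ≤ ∣ D m ∣ * ∣ f m ∣
    cg/K≤Df m M≤m = *-cancelˡ-≤-pos K (begin
      K * (c * 1/ K * ∣ g m ∣)    ≡⟨ solve 4 (λ K c K⁻¹ x → K :* (c :* K⁻¹ :* x) := (K :* K⁻¹) :* (c :* x)) refl K c (1/ K) ∣ g m ∣ ⟩
      K * 1/ K * (c * ∣ g m ∣)    ≡⟨ cong (_* (c * ∣ g m ∣)) (*-inverseʳ K) ⟩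
      1ℚ * (c * ∣ g m ∣)          ≡⟨ *-identityˡ (c * ∣ g m ∣) ⟩
      c * ∣ g m ∣                 ≤⟨ cg≤G m M₂≤m ⟩
      ∣ G m ∣                     ≤⟨ G≤FD m ⟩
      ∣ F m ∣ * ∣ D m ∣           ≤⟨ *-monoʳ-≤-nonNeg ∣ D m ∣ {{∣-∣-nonNeg (D m)}} (∣F∣≤K∣f∣ m M₁≤m) ⟩
      K * ∣ f m ∣ * ∣ D m ∣       ≡⟨ solve 3 (λ K f d → K :* f :* d := K :* (d :* f)) refl K ∣ f m ∣ ∣ D m ∣ ⟩
      K * (∣ D m ∣ * ∣ f m ∣)     ∎)
      where
      open ≤-Reasoning
      M₁≤m : M₁ ℕ.≤ m
      M₁≤m = ℕ.≤-trans (ℕ.m≤m⊔n M₁ M₂) M≤m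
      M₂≤m : M₂ ℕ.≤ m
      M₂≤m = ℕ.≤-trans (ℕ.m≤n⊔m M₁ M₂) M≤m

lemma8 : (n : ℕ → ℕ) (F G : (m : ℕ) → Family (n m))
         (zF zG zD : ℕ → ℕ) (f g : ℕ → ℚ) →
         (∀ m → F m ⊇ᶠ G m) →
         (∀ m → IsZ (F m) (zF m)) →
         (∀ m → IsZ (G m) (zG m)) →
         (∀ m → IsZ (F m ∖ᶠ G m) (zD m)) →
         IsBigO (λ m → ℕ→ℚ (zF m)) f →
         IsBigΩ (λ m → ℕ→ℚ (zG m)) g →
         IsBigΩRatio (λ m → ℕ→ℚ (zD m)) g f
lemma8 n F G zF zG zD f g F⊇G isF isG isD =
  bigΩ-ratio (ℕ→ℚ ∘ zF) (ℕ→ℚ ∘ zG) (ℕ→ℚ ∘ zD) f g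
    (λ m → ∣ℕ→ℚ∣-mono-≤-* {zG m} {zF m} {zD m} (IsZ-⊇-≤ (F⊇G m) (isF m) (isG m) (isD m)))
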